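{- Let $A,a$ be positive integers with $a>A$. Then for every non-negative integer $n$, $$p_{A,a}(n-(a-A))=\overline{p}_{A,a-A}(n).$$
   Context: A partition of $n$ is a finite multiset of positive integers summing to $n$. For positive integers $A,a$ and a partition $\pi$, $\mathrm{mex}_{A,a}(\pi)$ is the smallest element of $\{a,a+A,a+2A,\dots\}$ that is not a part of $\pi$. $p_{A,a}(n)$ (resp. $\overline{p}_{A,a}(n)$) is the number of partitions $\pi$ of $n$ with $\mathrm{mex}_{A,a}(\pi)\equiv a \pmod{2A}$ (resp. $\equiv A+a \pmod{2A}$); by convention $p_{A,a}(m)=0$ for $m<0$. -}

module Defs where

open import Data.Nat using (ℕ; zero; suc; _+_; _*_; _∸_; _⊓_; _≟_)
open import Data.Nat.Divisibility using (_∣?_)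
open import Data.Integer using (ℤ; +_; -[1+_])
open import Data.List using (List; []; _∷_; length; map; concatMap; filter; upTo)
open import Data.List.Membership.DecPropositional _≟_ using (_∈?_)
open import Relation.Nullary using (yes; no)

-- Partitions are represented as non-increasing lists of positive integers.
-- partsFuel f k n : all non-increasing lists of positive integers, each ≤ k,
-- summing to n (fuel f ≥ n suffices, since each step removes a part ≥ 1).
partsFuel : ℕ → ℕ → ℕ → List (List ℕ)
partsFuel f       k zero    = [] ∷ []
partsFuel zero    k (suc n) = []
partsFuel (suc f) k (suc n) =
  concatMap (λ i → map (suc i ∷_) (partsFuel f (suc i) (suc n ∸ suc i)))
            (upTo (k ⊓ suc n))

partitions : ℕ → List (List ℕ)
partitions n = partsFuel n n n

-- Fuel
-- suc (length π) is always enough when A ≥ 1, since the progression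
-- is strictly increasing and π has at most length π distinct elements.
mexFuel : ℕ → ℕ → List ℕ → ℕ → ℕ
mexFuel zero    A π x = x
mexFuel (suc f) A π x with x ∈? π
... | yes _ = mexFuel f A π (x + A)
... | no  _ = x

mex : ℕ → ℕ → List ℕ → ℕ
mex A a π = mexFuel (suc (length π)) A π a

-- p_{A,a}(n): partitions of n with mex_{A,a}(π) ≡ a (mod 2A).
-- Since mex ≥ a, this is 2A ∣ (mex − a).
p : ℕ → ℕ → ℕ → ℕ
p A a n = length (filter (λ π → (2 * A) ∣? (mex A a π ∸ a)) (partitions n))

-- p̄_{A,a}(n): partitions of n with mex_{A,a}(π) ≡ A + a (mod 2A).
-- Written as 2A ∣ ((mex + 2A) − (A + a)); the subtraction is exact since
-- mex ≥ a, so this is exactly mex ≡ A + a (mod 2A).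
pbar : ℕ → ℕ → ℕ → ℕ
pbar A a n = length (filter (λ π → (2 * A) ∣? ((mex A a π + 2 * A) ∸ (A + a))) (partitions n))

pℤ : ℕ → ℕ → ℤ → ℕ
pℤ A a (+ m)     = p A a m
pℤ A a -[1+ m ]  = 0

{-# OPTIONS --safe #-}
-- Put b = a − A.  If mex_{A,b}(π) ≡ A + b (mod 2A) then mex_{A,b}(π) ≠ b,
-- so b is a part of π.  Deleting one copy of b gives a partition of n − b
-- whose mex_{A,a} equals mex_{A,b}(π), because a = b + A is the next term of
-- the progression b, b + A, ….  Re-inserting b undoes this, so the two
-- classes of partitions are in bijection.  When n < b no partition of n has
-- b as a part, and both sides vanish.
module Submission where

open import Defs
open import Data.Nat using (ℕ; _<_; _∸_)
open import Data.Integer using (+_; _-_)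
open import Relation.Binary.PropositionalEquality using (_≡_)

open import Data.Nat using (zero; suc; _+_; _*_; _≤_; _⊓_; _≟_; _≤?_; z≤n; s≤s)
open import Data.Nat.Properties
open import Data.Nat.Divisibility using (_∣_; _∣?_; ∣m+n∣m⇒∣n; ∣m∣n⇒∣m+n; ∣-refl; ∣⇒≤)
open import Data.Nat.ListAction using (sum)
open import Algebra.Properties.CommutativeSemigroup +-commutativeSemigroup using (x∙yz≈y∙xz)
open import Data.Integer using (_⊖_; -_)
open import Data.Integer.Properties using (m-n≡m⊖n; ⊖-≥; ⊖-<)
open import Data.List using (List; []; _∷_; length; map; concatMap; filter; upTo; _++_)
open import Data.List.Properties using (length-++; ∷-injectiveʳ; ∷-injectiveˡ; filter-none)
open import Data.List.Membership.Propositional using (_∈_; _∉_; find; lose)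
open import Data.List.Membership.Propositional.Properties
  using (∈-concatMap⁺; ∈-concatMap⁻; ∈-map⁺; ∈-map⁻; ∈-upTo⁺; ∈-upTo⁻; ∈-∃++; ∈-++⁻; ∈-++⁺ˡ; ∈-++⁺ʳ; ∈-filter⁺; ∈-filter⁻)
open import Data.List.Membership.DecPropositional _≟_ using (_∈?_)
open import Data.List.Relation.Unary.Any using (here; there)
open import Data.List.Relation.Unary.All as All using (All)
import Data.List.Relation.Unary.All.Properties as All
import Data.List.Relation.Unary.AllPairs as AllPairs
import Data.List.Relation.Unary.AllPairs.Properties as AllPairs
open import Data.List.Relation.Unary.Unique.Propositional using (Unique; []; _∷_)
open import Data.List.Relation.Unary.Unique.Propositional.Properties using (concat⁺; map⁺; upTo⁺; filter⁺)
open import Data.List.Relation.Binary.Disjoint.Propositional using (Disjoint)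
open import Data.Product using (_×_; _,_; proj₁)
open import Data.Sum using (_⊎_; inj₁; inj₂)
open import Data.Unit using (⊤; tt)
open import Function.Bundles using (_⇔_; mk⇔; Equivalence)
open import Relation.Nullary using (¬_; Dec; yes; no; contradiction)
open import Relation.Nullary.Decidable using (decidable-stable)
open import Relation.Binary.PropositionalEquality using (refl; sym; trans; cong; subst; _≢_; module ≡-Reasoning)

Partition≤ : ℕ → List ℕ → Set
Partition≤ k []      = ⊤
Partition≤ k (x ∷ π) = 0 < x × x ≤ k × Partition≤ x π

Partition≤-weaken : ∀ {k l} π → k ≤ l → Partition≤ k π → Partition≤ l π
Partition≤-weaken []      _   _               = tt
Partition≤-weaken (x ∷ π) k≤l (0<x , x≤k , v) = 0<x , ≤-trans x≤k k≤l , v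

Partition≤-sum : ∀ {k} π → Partition≤ k π → Partition≤ (sum π) π
Partition≤-sum []      _               = tt
Partition≤-sum (x ∷ π) (0<x , _ , v) = 0<x , m≤m+n x (sum π) , v

Partition≤-bound : ∀ {k y} π → Partition≤ k π → y ∈ π → y ≤ k
Partition≤-bound (x ∷ π) (_ , x≤k , _) (here refl) = x≤k
Partition≤-bound (x ∷ π) (_ , x≤k , v) (there y∈π) = ≤-trans (Partition≤-bound π v y∈π) x≤k

concatMap-unique : ∀ {A B : Set} {g : A → List B} {xs} → Unique xs → (∀ x → Unique (g x)) →
                   (∀ {x y} → x ≢ y → Disjoint (g x) (g y)) → Unique (concatMap g xs)
concatMap-unique xs! g! g# =
  concat⁺ (All.map⁺ (All.tabulate (λ {x} _ → g! x))) (AllPairs.map⁺ (AllPairs.map g# xs!))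

∈-partsFuel⁻ : ∀ f k n {π} → π ∈ partsFuel f k n → Partition≤ k π × sum π ≡ n
∈-partsFuel⁻ f       k zero    (here refl) = tt , refl
∈-partsFuel⁻ zero    k (suc n) ()
∈-partsFuel⁻ (suc f) k (suc n) π∈
  with i , i∈ , π∈i ← find (∈-concatMap⁻ _ {xs = upTo (k ⊓ suc n)} π∈)
  with π , π∈′ , refl ← ∈-map⁻ (suc i ∷_) π∈i
  with v , sum≡ ← ∈-partsFuel⁻ f (suc i) (n ∸ i) π∈′
  = (s≤s z≤n , ≤-trans i<k⊓ (m⊓n≤m k (suc n)) , v)
  , trans (cong (_+_ (suc i)) sum≡) (m+[n∸m]≡n (≤-trans i<k⊓ (m⊓n≤n k (suc n))))
  where
  i<k⊓ : i < k ⊓ suc n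
  i<k⊓ = ∈-upTo⁻ i∈

∈-partsFuel⁺ : ∀ f k n {π} → Partition≤ k π → sum π ≡ n → n ≤ f → π ∈ partsFuel f k n
∈-partsFuel⁺ f       k _ {[]}        _             refl _          = here refl
∈-partsFuel⁺ zero    k _ {suc i ∷ π} _             refl ()
∈-partsFuel⁺ (suc f) k _ {suc i ∷ π} (_ , i<k , v) refl (s≤s n≤f) =
  ∈-concatMap⁺ _ (lose i∈ (∈-map⁺ (suc i ∷_) (∈-partsFuel⁺ f (suc i) _ v (sym rest≡) rest≤f)))
  where
  i∈ : i ∈ upTo (k ⊓ suc (i + sum π))
  i∈ = ∈-upTo⁺ (⊓-pres-m< i<k (s≤s (m≤m+n i (sum π))))
  rest≡ : i + sum π ∸ i ≡ sum π
  rest≡ = m+n∸m≡n i (sum π)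
  rest≤f : i + sum π ∸ i ≤ f
  rest≤f = subst (_≤ f) (sym rest≡) (≤-trans (m≤n+m (sum π) i) n≤f)

partsFuel-unique : ∀ f k n → Unique (partsFuel f k n)
partsFuel-unique f       k zero    = All.[] ∷ []
partsFuel-unique zero    k (suc n) = []
partsFuel-unique (suc f) k (suc n) =
  concatMap-unique (upTo⁺ (k ⊓ suc n)) (λ i → map⁺ ∷-injectiveʳ (partsFuel-unique f (suc i) (n ∸ i))) blocks#
  where
  blocks# : ∀ {i j} → i ≢ j → Disjoint (map (suc i ∷_) (partsFuel f (suc i) (n ∸ i)))
                                      (map (suc j ∷_) (partsFuel f (suc j) (n ∸ j)))
  blocks# i≢j (v∈i , v∈j) with _ , _ , refl ← ∈-map⁻ _ v∈i | _ , _ , eq ← ∈-map⁻ _ v∈j =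
    i≢j (suc-injective (∷-injectiveˡ eq))

∈-partitions⁻ : ∀ {n π} → π ∈ partitions n → Partition≤ n π × sum π ≡ n
∈-partitions⁻ {n} = ∈-partsFuel⁻ n n n

∈-partitions⁺ : ∀ {k n π} → Partition≤ k π → sum π ≡ n → π ∈ partitions n
∈-partitions⁺ {π = π} v refl = ∈-partsFuel⁺ _ _ _ (Partition≤-sum π v) refl ≤-refl

partitions-unique : ∀ n → Unique (partitions n)
partitions-unique n = partsFuel-unique n n n

injectiveOn⇒length≤ : ∀ {A B : Set} (f : A → B) {xs ys} → Unique xs → (∀ {x} → x ∈ xs → f x ∈ ys) →
                      (∀ {x y} → x ∈ xs → y ∈ xs → f x ≡ f y → x ≡ y) → length xs ≤ length ys
injectiveOn⇒length≤ f {[]}     _           _    _   = z≤n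
injectiveOn⇒length≤ f {x ∷ xs} (x∉xs ∷ xs!) into inj
  with us , vs , refl ← ∈-∃++ (into (here refl)) =
  subst (suc (length xs) ≤_) (sym length≡)
    (s≤s (injectiveOn⇒length≤ f xs! into′ (λ p q → inj (there p) (there q))))
  where
  length≡ : length (us ++ f x ∷ vs) ≡ suc (length (us ++ vs))
  length≡ = trans (length-++ us) (trans (+-suc _ _) (cong suc (sym (length-++ us))))
  into′ : ∀ {y} → y ∈ xs → f y ∈ us ++ vs
  into′ {y} y∈ with ∈-++⁻ us (into (there y∈))
  ... | inj₁ p         = ∈-++⁺ˡ p
  ... | inj₂ (here eq) = contradiction (inj (here refl) (there y∈) (sym eq)) (All.lookup x∉xs y∈)
  ... | inj₂ (there p) = ∈-++⁺ʳ us p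

inverseOn⇒length≡ : ∀ {A B : Set} (f : A → B) (g : B → A) {xs ys} → Unique xs → Unique ys →
                    (∀ {x} → x ∈ xs → f x ∈ ys) → (∀ {y} → y ∈ ys → g y ∈ xs) →
                    (∀ {x} → x ∈ xs → g (f x) ≡ x) → (∀ {y} → y ∈ ys → f (g y) ≡ y) →
                    length xs ≡ length ys
inverseOn⇒length≡ f g xs! ys! f∈ g∈ gf fg = ≤-antisym
  (injectiveOn⇒length≤ f xs! f∈ (λ p q eq → trans (sym (gf p)) (trans (cong g eq) (gf q))))
  (injectiveOn⇒length≤ g ys! g∈ (λ p q eq → trans (sym (fg p)) (trans (cong f eq) (fg q))))

insert : ℕ → List ℕ → List ℕ
insert b []      = b ∷ []
insert b (x ∷ π) with x ≤? b
... | yes _ = b ∷ x ∷ π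
... | no  _ = x ∷ insert b π

remove : ℕ → List ℕ → List ℕ
remove b []      = []
remove b (x ∷ π) with x ≟ b
... | yes _ = π
... | no  _ = x ∷ remove b π

length-insert : ∀ b π → length (insert b π) ≡ suc (length π)
length-insert b []      = refl
length-insert b (x ∷ π) with x ≤? b
... | yes _ = refl
... | no  _ = cong suc (length-insert b π)

sum-insert : ∀ b π → sum (insert b π) ≡ b + sum π
sum-insert b []      = refl
sum-insert b (x ∷ π) with x ≤? b
... | yes _ = refl
... | no  _ = trans (cong (_+_ x) (sum-insert b π)) (x∙yz≈y∙xz x b (sum π))

insert-Partition≤ : ∀ {k} b π → 0 < b → b ≤ k → Partition≤ k π → Partition≤ k (insert b π)
insert-Partition≤ b []      0<b b≤k _ = 0<b , b≤k , tt
insert-Partition≤ b (x ∷ π) 0<b b≤k (0<x , x≤k , v) with x ≤? b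
... | yes x≤b = 0<b , b≤k , 0<x , x≤b , v
... | no  x≰b = 0<x , x≤k , insert-Partition≤ b π 0<b (<⇒≤ (≰⇒> x≰b)) v

∈-insert : ∀ b π → b ∈ insert b π
∈-insert b []      = here refl
∈-insert b (x ∷ π) with x ≤? b
... | yes _ = here refl
... | no  _ = there (∈-insert b π)

∈-insert⁺ : ∀ b π {y} → y ∈ π → y ∈ insert b π
∈-insert⁺ b (x ∷ π) y∈ with x ≤? b
∈-insert⁺ b (x ∷ π) y∈          | yes _ = there y∈
∈-insert⁺ b (x ∷ π) (here y≡x)  | no  _ = here y≡x
∈-insert⁺ b (x ∷ π) (there y∈π) | no  _ = there (∈-insert⁺ b π y∈π)

∈-insert⁻ : ∀ b π {y} → y ∈ insert b π → y ≡ b ⊎ y ∈ π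
∈-insert⁻ b []      (here y≡b) = inj₁ y≡b
∈-insert⁻ b (x ∷ π) y∈ with x ≤? b
∈-insert⁻ b (x ∷ π) (here y≡b)  | yes _ = inj₁ y≡b
∈-insert⁻ b (x ∷ π) (there y∈)  | yes _ = inj₂ y∈
∈-insert⁻ b (x ∷ π) (here y≡x)  | no  _ = inj₂ (here y≡x)
∈-insert⁻ b (x ∷ π) (there y∈)  | no  _ with ∈-insert⁻ b π y∈
... | inj₁ y≡b  = inj₁ y≡b
... | inj₂ y∈π = inj₂ (there y∈π)

remove-head : ∀ b π → remove b (b ∷ π) ≡ π
remove-head b π with b ≟ b
... | yes _   = refl
... | no  b≢b = contradiction refl b≢b

remove-insert : ∀ b π → remove b (insert b π) ≡ π
remove-insert b []      = remove-head b []
remove-insert b (x ∷ π) with x ≤? b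
... | yes _ = remove-head b (x ∷ π)
... | no  x≰b with x ≟ b
...   | yes refl = contradiction ≤-refl x≰b
...   | no  _    = cong (x ∷_) (remove-insert b π)

insert-head : ∀ {k} x π → Partition≤ k (x ∷ π) → insert x π ≡ x ∷ π
insert-head x []      _                     = refl
insert-head x (y ∷ π) (_ , _ , _ , y≤x , _) with y ≤? x
... | yes _   = refl
... | no  y≰x = contradiction y≤x y≰x

insert-remove : ∀ {k} b π → Partition≤ k π → b ∈ π → insert b (remove b π) ≡ π
insert-remove b (x ∷ π) v@(_ , _ , vπ) b∈ with x ≟ b
... | yes refl = insert-head x π v
... | no  x≢b with b∈
...   | here b≡x   = contradiction (sym b≡x) x≢b
...   | there b∈π with x ≤? b
...     | yes x≤b = contradiction (≤-antisym x≤b (Partition≤-bound π vπ b∈π)) x≢b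
...     | no  _   = cong (x ∷_) (insert-remove b π vπ b∈π)

remove-Partition≤ : ∀ {k} b π → Partition≤ k π → Partition≤ k (remove b π)
remove-Partition≤ b []      _                  = tt
remove-Partition≤ b (x ∷ π) (0<x , x≤k , v) with x ≟ b
... | yes _ = Partition≤-weaken π x≤k v
... | no  _ = 0<x , x≤k , remove-Partition≤ b π v

sum-remove : ∀ b π → b ∈ π → b + sum (remove b π) ≡ sum π
sum-remove b (x ∷ π) b∈ with x ≟ b
... | yes refl = refl
... | no  x≢b with b∈
...   | here b≡x  = contradiction (sym b≡x) x≢b
...   | there b∈π = trans (x∙yz≈y∙xz b x _) (cong (_+_ x) (sum-remove b π b∈π))

x≤mexFuel : ∀ f A π x → x ≤ mexFuel f A π x
x≤mexFuel zero    A π x = ≤-refl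
x≤mexFuel (suc f) A π x with x ∈? π
... | yes _ = ≤-trans (m≤m+n x A) (x≤mexFuel f A π (x + A))
... | no  _ = ≤-refl

a≤mex : ∀ A a π → a ≤ mex A a π
a≤mex A a π = x≤mexFuel _ A π a

mexFuel-cong : ∀ f A {π π′} x → (∀ {y} → x ≤ y → y ∈ π ⇔ y ∈ π′) →
               mexFuel f A π x ≡ mexFuel f A π′ x
mexFuel-cong zero    A           x _ = refl
mexFuel-cong (suc f) A {π} {π′} x same with x ∈? π | x ∈? π′
... | yes _  | yes _  = mexFuel-cong f A (x + A) (λ x+A≤y → same (≤-trans (m≤m+n x A) x+A≤y))
... | yes x∈ | no  x∉ = contradiction (Equivalence.to (same ≤-refl) x∈) x∉
... | no  x∉ | yes x∈ = contradiction (Equivalence.from (same ≤-refl) x∈) x∉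
... | no  _  | no  _  = refl

mex-insert : ∀ {A} b π → 0 < A → mex A b (insert b π) ≡ mex A (b + A) π
mex-insert {A} b π 0<A rewrite length-insert b π with b ∈? insert b π
... | no  b∉ = contradiction (∈-insert b π) b∉
... | yes _  =
  mexFuel-cong (suc (length π)) A (b + A) (λ b+A≤y → mk⇔ (∈-insert⁻-above b+A≤y) (∈-insert⁺ b π))
  where
  ∈-insert⁻-above : ∀ {y} → b + A ≤ y → y ∈ insert b π → y ∈ π
  ∈-insert⁻-above b+A≤y y∈ with ∈-insert⁻ b π y∈
  ... | inj₁ refl = contradiction b+A≤y (<⇒≱ (m<m+n b 0<A))
  ... | inj₂ y∈π  = y∈π

mex-∉ : ∀ A b π → b ∉ π → mex A b π ≡ b
mex-∉ A b π b∉π with b ∈? π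
... | yes b∈π = contradiction b∈π b∉π
... | no  _   = refl

2*n∤n : ∀ n → 0 < n → ¬ (2 * n ∣ n)
2*n∤n (suc m) _ 2n∣n = <⇒≱ (m<m+n (suc m) (s≤s z≤n)) (∣⇒≤ 2n∣n)

d∣m+d⇔d∣m : ∀ {d m} → d ∣ m + d ⇔ d ∣ m
d∣m+d⇔d∣m {d} {m} = mk⇔
  (λ d∣m+d → ∣m+n∣m⇒∣n (subst (d ∣_) (+-comm m d) d∣m+d) ∣-refl)
  (λ d∣m → ∣m∣n⇒∣m+n d∣m ∣-refl)

pℤ-negative : ∀ A a {k} → 0 < k → pℤ A a (- + k) ≡ 0
pℤ-negative A a {suc k} _ = refl

m-[n-o]≡m⊖[n∸o] : ∀ m {n o} → o ≤ n → + m - (+ n - + o) ≡ m ⊖ (n ∸ o)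
m-[n-o]≡m⊖[n∸o] m {n} {o} o≤n =
  trans (cong (λ k → + m - k) (trans (m-n≡m⊖n n o) (⊖-≥ o≤n))) (m-n≡m⊖n m (n ∸ o))

module RemovePart (A b : ℕ) (0<A : 0 < A) (0<b : 0 < b) where

  a : ℕ
  a = b + A

  PClass : List ℕ → Set
  PClass π = 2 * A ∣ mex A a π ∸ a

  P̄Class : List ℕ → Set
  P̄Class π = 2 * A ∣ (mex A b π + 2 * A) ∸ (A + b)

  PClass? : ∀ π → Dec (PClass π)
  PClass? π = 2 * A ∣? (mex A a π ∸ a)

  P̄Class? : ∀ π → Dec (P̄Class π)
  P̄Class? π = 2 * A ∣? ((mex A b π + 2 * A) ∸ (A + b))

  ¬P̄Class : ∀ {π} → b ∉ π → ¬ P̄Class π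
  ¬P̄Class {π} b∉π 2A∣ = 2*n∤n A 0<A (subst (2 * A ∣_) excess≡A 2A∣)
    where
    open ≡-Reasoning
    excess≡A : (mex A b π + 2 * A) ∸ (A + b) ≡ A
    excess≡A = begin
      (mex A b π + 2 * A) ∸ (A + b) ≡⟨ cong (λ m → (m + 2 * A) ∸ (A + b)) (mex-∉ A b π b∉π) ⟩
      (b + 2 * A) ∸ (A + b)         ≡⟨ cong ((b + 2 * A) ∸_) (+-comm A b) ⟩
      (b + (A + (A + 0))) ∸ (b + A) ≡⟨ [m+n]∸[m+o]≡n∸o b (A + (A + 0)) A ⟩
      (A + (A + 0)) ∸ A             ≡⟨ m+n∸m≡n A (A + 0) ⟩
      A + 0                         ≡⟨ +-identityʳ A ⟩
      A                             ∎

  b∈P̄Class : ∀ {π} → P̄Class π → b ∈ π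
  b∈P̄Class {π} 2A∣ = decidable-stable (b ∈? π) (λ b∉π → ¬P̄Class b∉π 2A∣)

  P̄Class-insert⇔PClass : ∀ π → P̄Class (insert b π) ⇔ PClass π
  P̄Class-insert⇔PClass π = subst (λ k → 2 * A ∣ k ⇔ PClass π) (sym excess≡) d∣m+d⇔d∣m
    where
    open ≡-Reasoning
    excess≡ : (mex A b (insert b π) + 2 * A) ∸ (A + b) ≡ (mex A a π ∸ a) + 2 * A
    excess≡ = begin
      (mex A b (insert b π) + 2 * A) ∸ (A + b) ≡⟨ cong (λ m → (m + 2 * A) ∸ (A + b)) (mex-insert b π 0<A) ⟩
      (mex A a π + 2 * A) ∸ (A + b)            ≡⟨ cong ((mex A a π + 2 * A) ∸_) (+-comm A b) ⟩
      (mex A a π + 2 * A) ∸ a                  ≡⟨ +-∸-comm (2 * A) (a≤mex A a π) ⟩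
      (mex A a π ∸ a) + 2 * A                  ∎

  insert-remove-P̄Class : ∀ {k π} → Partition≤ k π → P̄Class π → insert b (remove b π) ≡ π
  insert-remove-P̄Class {π = π} v 2A∣ = insert-remove b π v (b∈P̄Class 2A∣)

  module _ {n} (b≤n : b ≤ n) where

    insert-∈ : ∀ {π} → π ∈ filter PClass? (partitions (n ∸ b)) →
               insert b π ∈ filter P̄Class? (partitions n)
    insert-∈ {π} π∈ with π∈′ , inP ← ∈-filter⁻ PClass? π∈ with v , sum≡ ← ∈-partitions⁻ π∈′ =
      ∈-filter⁺ P̄Class? (∈-partitions⁺ v′ sum≡′) (Equivalence.from (P̄Class-insert⇔PClass π) inP)
      where
      v′ : Partition≤ n (insert b π)
      v′ = insert-Partition≤ b π 0<b b≤n (Partition≤-weaken π (m∸n≤m n b) v)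
      sum≡′ : sum (insert b π) ≡ n
      sum≡′ = trans (sum-insert b π) (trans (cong (_+_ b) sum≡) (m+[n∸m]≡n b≤n))

    remove-∈ : ∀ {π} → π ∈ filter P̄Class? (partitions n) →
               remove b π ∈ filter PClass? (partitions (n ∸ b))
    remove-∈ {π} π∈ with π∈′ , inP̄ ← ∈-filter⁻ P̄Class? π∈ with v , sum≡ ← ∈-partitions⁻ π∈′ =
      ∈-filter⁺ PClass? (∈-partitions⁺ (remove-Partition≤ b π v) sum≡′)
        (Equivalence.to (P̄Class-insert⇔PClass (remove b π))
          (subst P̄Class (sym (insert-remove-P̄Class v inP̄)) inP̄))
      where
      sum≡′ : sum (remove b π) ≡ n ∸ b
      sum≡′ = trans (sym (m+n∸m≡n b _)) (cong (_∸ b) (trans (sum-remove b π (b∈P̄Class inP̄)) sum≡))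

    p≡pbar : p A a (n ∸ b) ≡ pbar A b n
    p≡pbar = inverseOn⇒length≡ (insert b) (remove b)
      (filter⁺ PClass? (partitions-unique (n ∸ b))) (filter⁺ P̄Class? (partitions-unique n))
      insert-∈ remove-∈ (λ {π} _ → remove-insert b π) insert-remove-∈
      where
      insert-remove-∈ : ∀ {π} → π ∈ filter P̄Class? (partitions n) → insert b (remove b π) ≡ π
      insert-remove-∈ π∈ with π∈′ , inP̄ ← ∈-filter⁻ P̄Class? π∈ =
        insert-remove-P̄Class (proj₁ (∈-partitions⁻ {n} π∈′)) inP̄

  pbar-below : ∀ {n} → n < b → pbar A b n ≡ 0
  pbar-below n<b = cong length (filter-none P̄Class? (All.tabulate λ π∈ inP̄ →
    <⇒≱ n<b (Partition≤-bound _ (proj₁ (∈-partitions⁻ π∈)) (b∈P̄Class inP̄))))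

  pℤ-⊖ : ∀ n → pℤ A a (n ⊖ b) ≡ pbar A b n
  pℤ-⊖ n with b ≤? n
  ... | yes b≤n = trans (cong (pℤ A a) (⊖-≥ b≤n)) (p≡pbar b≤n)
  ... | no  b≰n = trans (cong (pℤ A a) (⊖-< n<b))
                   (trans (pℤ-negative A a (m<n⇒0<n∸m n<b)) (sym (pbar-below n<b)))
    where
    n<b : n < b
    n<b = ≰⇒> b≰n

theorem5p1 : (A a : ℕ) → 0 < A → A < a → (n : ℕ) →
    pℤ A a (+ n - (+ a - + A)) ≡ pbar A (a ∸ A) n
theorem5p1 A a 0<A A<a n = begin
  pℤ A a (+ n - (+ a - + A))       ≡⟨ cong (pℤ A a) (m-[n-o]≡m⊖[n∸o] n A≤a) ⟩
  pℤ A a (n ⊖ (a ∸ A))             ≡⟨ cong (λ c → pℤ A c (n ⊖ (a ∸ A))) (sym (m∸n+n≡m A≤a)) ⟩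
  pℤ A (a ∸ A + A) (n ⊖ (a ∸ A))   ≡⟨ RemovePart.pℤ-⊖ A (a ∸ A) 0<A (m<n⇒0<n∸m A<a) n ⟩
  pbar A (a ∸ A) n                 ∎
  where
  open ≡-Reasoning
  A≤a : A ≤ a
  A≤a = <⇒≤ A<a
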